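{- For every integer $n\ge 3$, $$|L_n(6)|+|L_n(7)|=|L_{n-1}(3)|+|L_{n-1}(4)|+|L_{n-1}(5)|+|L_{n-1}(6)|+|L_{n-1}(7)|+1.$$
   Context: For $n\ge1$, let $L_n$ be the set of words $a=a_1\cdots a_n$ over $\{1,2,3,4\}$ with $0<a_i\le \max_{0\le j<i}a_j+1$ for all $i$, where by convention $a_0=1$. Let $E_i$ denote erasing the $i$-th letter (from the left) of a word. Define $L_n(1)=\{a\in L_n:a_n=1\}$, $L_n(2)=\{a\in L_n: a_n=\max_{0\le j<n}a_j+1\text{ or }a_n=4\}$, and for $n\ge2$ and $k\in\{1,2,3,4\}$, $L_n(k+2)=\{a\in L_n\setminus(L_n(1)\cup L_n(2)): a_{n-1}=k,\ E_{n-1}(a)\notin L_{n-1}(1)\cup L_{n-1}(2)\}$. Finally $L_n(7)=L_n\setminus\bigcup_{i=1}^6 L_n(i)$. -}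

module Defs where

open import Data.Nat using (ℕ; zero; suc; _+_; _∸_; _⊔_; _≡ᵇ_; _≤ᵇ_)
open import Data.Bool using (Bool; true; false; _∧_; _∨_; not)
open import Data.List using (List; []; _∷_; length; take; drop; _++_; map; concatMap; filterᵇ; foldl)

alphabet : List ℕ
alphabet = 1 ∷ 2 ∷ 3 ∷ 4 ∷ []

words : ℕ → List (List ℕ)
words zero    = [] ∷ []
words (suc n) = concatMap (λ w → map (λ x → x ∷ w) alphabet) (words n)

-- validity: 0 < a_i ≤ max_{0≤j<i} a_j + 1, with a_0 = 1; m is the running max
validFrom : ℕ → List ℕ → Bool
validFrom m []       = true
validFrom m (x ∷ xs) = (1 ≤ᵇ x) ∧ (x ≤ᵇ suc m) ∧ (x ≤ᵇ 4) ∧ validFrom (m ⊔ x) xs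

inL : ℕ → List ℕ → Bool
inL n a = (length a ≡ᵇ n) ∧ validFrom 1 a

-- i-th letter (1-indexed), 0 if out of range
letter : ℕ → List ℕ → ℕ
letter i       []       = 0
letter zero    (x ∷ xs) = 0
letter (suc zero) (x ∷ xs) = x
letter (suc (suc i)) (x ∷ xs) = letter (suc i) xs

-- max_{0≤j≤k} a_j with a_0 = 1, i.e. max of 1 and the first k letters
maxPrefix : ℕ → List ℕ → ℕ
maxPrefix k a = foldl _⊔_ 1 (take k a)

-- E_i : erase the i-th letter (1-indexed)
erase : ℕ → List ℕ → List ℕ
erase i a = take (i ∸ 1) a ++ drop i a

in1 : ℕ → List ℕ → Bool
in1 n a = inL n a ∧ (letter n a ≡ᵇ 1)

in2 : ℕ → List ℕ → Bool
in2 n a = inL n a ∧ ((letter n a ≡ᵇ suc (maxPrefix (n ∸ 1) a)) ∨ (letter n a ≡ᵇ 4))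

-- a ∈ L_n(k+2), k ∈ {1,2,3,4}
inK : ℕ → ℕ → List ℕ → Bool
inK n k a = inL n a ∧ not (in1 n a ∨ in2 n a) ∧ (letter (n ∸ 1) a ≡ᵇ k)
            ∧ not (in1 (n ∸ 1) (erase (n ∸ 1) a) ∨ in2 (n ∸ 1) (erase (n ∸ 1) a))

in7 : ℕ → List ℕ → Bool
in7 n a = inL n a ∧ not (in1 n a ∨ in2 n a ∨ inK n 1 a ∨ inK n 2 a ∨ inK n 3 a ∨ inK n 4 a)

inClass : ℕ → ℕ → List ℕ → Bool
inClass n 1 a = in1 n a
inClass n 2 a = in2 n a
inClass n 3 a = inK n 1 a
inClass n 4 a = inK n 2 a
inClass n 5 a = inK n 3 a
inClass n 6 a = inK n 4 a
inClass n 7 a = in7 n a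
inClass n _ a = false

card : ℕ → ℕ → ℕ
card n i = length (filterᵇ (inClass n i) (words n))

-- Whether a word v ++ r with |r| ≥ 2 lies in L_n(i) depends on the prefix v
-- only through its context: whether v is valid, and its maximum m (with a_0 = 1).
-- A valid prefix has m ∈ {1,2,3,4}. Splitting a word of length n into a prefix of
-- length n − 3 and a suffix of length 3 (and a word of length n − 1 into the same
-- prefixes and suffixes of length 2) reduces the identity to one between suffix
-- counts for each context, which is checked by computation. The two sides agree
-- except in the context (valid, m = 1), where the left side has one word more; and
-- exactly one prefix of each length, 1⋯1, has that context.
module Submission where

open import Defs
open import Algebra.Properties.CommutativeSemigroup using (interchange)
open import Data.Bool using (Bool; true; false; T; _∧_; _∨_; not)
open import Data.Bool.Properties using (T-∧; ∧-zeroʳ)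
open import Data.List using (List; []; _∷_; length; take; drop; _++_; map; concatMap; filterᵇ; foldl)
open import Data.List.Properties using (map-++; ++-assoc; foldl-++)
open import Data.Nat using (ℕ; zero; suc; _+_; _∸_; _≤_; z≤n; s≤s; _⊔_; _≡ᵇ_; _≤ᵇ_)
open import Data.Nat.ListAction using (sum)
open import Data.Nat.ListAction.Properties using (sum-++)
open import Data.Nat.Properties
  using (+-commutativeSemigroup; +-comm; +-suc; +-identityʳ; +-∸-assoc; ≤-refl; ≤-trans; m≤m⊔n; ⊔-lub; ≤ᵇ⇒≤)
open import Data.Nat.Tactic.RingSolver using (solve-∀)
open import Data.Product using (_×_; _,_; proj₁; proj₂)
open import Function using (_∘_; Equivalence)
open import Relation.Binary.PropositionalEquality using (_≡_; refl; sym; trans; cong; cong₂; module ≡-Reasoning)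
open import Relation.Nullary using (contradiction)

open ≡-Reasoning
open Equivalence using (to)

variable
  A B : Set

∑ : List A → (A → ℕ) → ℕ
∑ xs f = sum (map f xs)

syntax ∑ xs (λ x → e) = ∑[ x ∈ xs ] e

𝟙 : Bool → ℕ
𝟙 true  = 1
𝟙 false = 0

∑-cong : ∀ (xs : List A) {f g : A → ℕ} → (∀ x → f x ≡ g x) → ∑ xs f ≡ ∑ xs g
∑-cong []       eq = refl
∑-cong (x ∷ xs) eq = cong₂ _+_ (eq x) (∑-cong xs eq)

∑-+ : ∀ (xs : List A) (f g : A → ℕ) → ∑[ x ∈ xs ] (f x + g x) ≡ ∑ xs f + ∑ xs g
∑-+ []       f g = refl
∑-+ (x ∷ xs) f g =
  trans (cong (f x + g x +_) (∑-+ xs f g)) (interchange +-commutativeSemigroup (f x) (g x) (∑ xs f) (∑ xs g))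

∑-zero : ∀ (xs : List A) → ∑[ x ∈ xs ] 0 ≡ 0
∑-zero []       = refl
∑-zero (x ∷ xs) = ∑-zero xs

∑-++ : ∀ (xs ys : List A) (f : A → ℕ) → ∑ (xs ++ ys) f ≡ ∑ xs f + ∑ ys f
∑-++ xs ys f = trans (cong sum (map-++ f xs ys)) (sum-++ (map f xs) (map f ys))

∑-concatMap : ∀ (g : A → List B) (xs : List A) (f : B → ℕ) →
              ∑ (concatMap g xs) f ≡ ∑[ x ∈ xs ] ∑ (g x) f
∑-concatMap g []       f = refl
∑-concatMap g (x ∷ xs) f =
  trans (∑-++ (g x) (concatMap g xs) f) (cong (∑ (g x) f +_) (∑-concatMap g xs f))

length-filterᵇ : ∀ (p : A → Bool) (xs : List A) → length (filterᵇ p xs) ≡ ∑[ x ∈ xs ] 𝟙 (p x)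
length-filterᵇ p [] = refl
length-filterᵇ p (x ∷ xs) with p x
... | true  = cong suc (length-filterᵇ p xs)
... | false = length-filterᵇ p xs

∑-swap : ∀ (xs : List A) (ys : List B) (h : A → B → ℕ) →
         ∑[ x ∈ xs ] ∑[ y ∈ ys ] h x y ≡ ∑[ y ∈ ys ] ∑[ x ∈ xs ] h x y
∑-swap []       ys h = sym (∑-zero ys)
∑-swap (x ∷ xs) ys h = begin
  ∑[ y ∈ ys ] h x y + ∑[ x′ ∈ xs ] ∑[ y ∈ ys ] h x′ y   ≡⟨ cong (∑[ y ∈ ys ] h x y +_) (∑-swap xs ys h) ⟩
  ∑[ y ∈ ys ] h x y + ∑[ y ∈ ys ] ∑[ x′ ∈ xs ] h x′ y   ≡⟨ sym (∑-+ ys (h x) _) ⟩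
  ∑[ y ∈ ys ] (h x y + ∑[ x′ ∈ xs ] h x′ y)             ∎

∑-words-suc : ∀ k (f : List ℕ → ℕ) → ∑ (words (suc k)) f ≡ ∑[ w ∈ words k ] ∑[ x ∈ alphabet ] f (x ∷ w)
∑-words-suc k f = ∑-concatMap (λ w → map (_∷ w) alphabet) (words k) f

∑-words-+ : ∀ k m (f : List ℕ → ℕ) → ∑ (words (k + m)) f ≡ ∑[ v ∈ words k ] ∑[ r ∈ words m ] f (v ++ r)
∑-words-+ zero    m f = sym (+-identityʳ _)
∑-words-+ (suc k) m f = begin
  ∑ (words (suc (k + m))) f                                        ≡⟨ ∑-words-suc (k + m) f ⟩
  ∑[ w ∈ words (k + m) ] ∑[ x ∈ alphabet ] f (x ∷ w)              ≡⟨ ∑-words-+ k m _ ⟩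
  ∑[ v ∈ words k ] ∑[ r ∈ words m ] ∑[ x ∈ alphabet ] f (x ∷ v ++ r)
    ≡⟨ ∑-cong (words k) (λ v → ∑-swap (words m) alphabet (λ r x → f (x ∷ v ++ r))) ⟩
  ∑[ v ∈ words k ] ∑[ x ∈ alphabet ] ∑[ r ∈ words m ] f (x ∷ v ++ r)
    ≡⟨ sym (∑-words-suc k _) ⟩
  ∑[ v ∈ words (suc k) ] ∑[ r ∈ words m ] f (v ++ r)              ∎

∑-words-cong : ∀ k {f g : List ℕ → ℕ} → (∀ v → length v ≡ k → f v ≡ g v) → ∑ (words k) f ≡ ∑ (words k) g
∑-words-cong zero    eq = cong (_+ 0) (eq [] refl)
∑-words-cong (suc k) {f} {g} eq = begin
  ∑ (words (suc k)) f                                  ≡⟨ ∑-words-suc k f ⟩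
  ∑[ w ∈ words k ] ∑[ x ∈ alphabet ] f (x ∷ w)
    ≡⟨ ∑-words-cong k (λ w len → ∑-cong alphabet (λ x → eq (x ∷ w) (cong suc len))) ⟩
  ∑[ w ∈ words k ] ∑[ x ∈ alphabet ] g (x ∷ w)         ≡⟨ sym (∑-words-suc k g) ⟩
  ∑ (words (suc k)) g                                  ∎

length-++-≡ᵇ : ∀ (v r : List A) n → (length (v ++ r) ≡ᵇ length v + n) ≡ (length r ≡ᵇ n)
length-++-≡ᵇ []      r n = refl
length-++-≡ᵇ (_ ∷ v) r n = length-++-≡ᵇ v r n

letter-++ : ∀ (v r : List ℕ) i → letter (length v + suc i) (v ++ r) ≡ letter (suc i) r
letter-++ v r i = trans (cong (λ p → letter p (v ++ r)) (+-suc (length v) i)) (go v)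
  where
  go : ∀ v → letter (suc (length v + i)) (v ++ r) ≡ letter (suc i) r
  go []      = refl
  go (_ ∷ v) = go v

take-++ : ∀ (v r : List A) k → take (length v + k) (v ++ r) ≡ v ++ take k r
take-++ []      r k = refl
take-++ (x ∷ v) r k = cong (x ∷_) (take-++ v r k)

drop-++ : ∀ (v r : List A) k → drop (length v + k) (v ++ r) ≡ drop k r
drop-++ []      r k = refl
drop-++ (_ ∷ v) r k = drop-++ v r k

+-suc-∸-1 : ∀ m n → m + suc n ∸ 1 ≡ m + n
+-suc-∸-1 m n = +-∸-assoc m (s≤s z≤n)

erase-++ : ∀ (v r : List ℕ) j → erase (length v + suc j) (v ++ r) ≡ v ++ erase (suc j) r
erase-++ v r j = begin
  take (length v + suc j ∸ 1) (v ++ r) ++ drop (length v + suc j) (v ++ r)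
    ≡⟨ cong (λ p → take p (v ++ r) ++ drop (length v + suc j) (v ++ r)) (+-suc-∸-1 (length v) j) ⟩
  take (length v + j) (v ++ r) ++ drop (length v + suc j) (v ++ r)
    ≡⟨ cong₂ _++_ (take-++ v r j) (drop-++ v r (suc j)) ⟩
  (v ++ take j r) ++ drop (suc j) r
    ≡⟨ ++-assoc v (take j r) (drop (suc j) r) ⟩
  v ++ erase (suc j) r ∎

validFrom-++ : ∀ m (v r : List ℕ) → validFrom m (v ++ r) ≡ validFrom m v ∧ validFrom (foldl _⊔_ m v) r
validFrom-++ m []      r = refl
validFrom-++ m (x ∷ v) r with 1 ≤ᵇ x | x ≤ᵇ suc m | x ≤ᵇ 4
... | true  | true  | true  = validFrom-++ (m ⊔ x) v r
... | true  | true  | false = refl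
... | true  | false | _     = refl
... | false | _     | _     = refl

m≤foldl-⊔ : ∀ m (v : List ℕ) → m ≤ foldl _⊔_ m v
m≤foldl-⊔ m []      = ≤-refl
m≤foldl-⊔ m (x ∷ v) = ≤-trans (m≤m⊔n m x) (m≤foldl-⊔ (m ⊔ x) v)

foldl-⊔-≤4 : ∀ {m} (v : List ℕ) → m ≤ 4 → T (validFrom m v) → foldl _⊔_ m v ≤ 4
foldl-⊔-≤4 []      m≤4 _     = m≤4
foldl-⊔-≤4 {m} (x ∷ v) m≤4 valid =
  foldl-⊔-≤4 v (⊔-lub m≤4 (≤ᵇ⇒≤ x 4 (proj₁ x≤4×valid))) (proj₂ x≤4×valid)
  where
  x≤4×valid : T (x ≤ᵇ 4) × T (validFrom (m ⊔ x) v)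
  x≤4×valid = to T-∧ (proj₂ (to (T-∧ {x ≤ᵇ suc m}) (proj₂ (to (T-∧ {1 ≤ᵇ x}) valid))))

record Context : Set where
  constructor ⟨_,_⟩
  field
    valid : Bool
    top   : ℕ

open Context

context : List ℕ → Context
context v = ⟨ validFrom 1 v , foldl _⊔_ 1 v ⟩

-- The classes of a suffix r, read as the letters n′+1, …, n′+n of a word whose
-- first n′ letters have context c; they mirror inL, in1, …, inClass letter by letter.
inLAfter : Context → ℕ → List ℕ → Bool
inLAfter c n r = (length r ≡ᵇ n) ∧ (valid c ∧ validFrom (top c) r)

in1After : Context → ℕ → List ℕ → Bool
in1After c n r = inLAfter c n r ∧ (letter n r ≡ᵇ 1)

in2After : Context → ℕ → List ℕ → Bool
in2After c n r = inLAfter c n r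
  ∧ ((letter n r ≡ᵇ suc (foldl _⊔_ (top c) (take (n ∸ 1) r))) ∨ (letter n r ≡ᵇ 4))

inKAfter : Context → ℕ → ℕ → List ℕ → Bool
inKAfter c n k r = inLAfter c n r ∧ not (in1After c n r ∨ in2After c n r) ∧ (letter (n ∸ 1) r ≡ᵇ k)
  ∧ not (in1After c (n ∸ 1) (erase (n ∸ 1) r) ∨ in2After c (n ∸ 1) (erase (n ∸ 1) r))

in7After : Context → ℕ → List ℕ → Bool
in7After c n r = inLAfter c n r ∧ not (in1After c n r ∨ in2After c n r
  ∨ inKAfter c n 1 r ∨ inKAfter c n 2 r ∨ inKAfter c n 3 r ∨ inKAfter c n 4 r)

inClassAfter : Context → ℕ → ℕ → List ℕ → Bool
inClassAfter c n 1 r = in1After c n r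
inClassAfter c n 2 r = in2After c n r
inClassAfter c n 3 r = inKAfter c n 1 r
inClassAfter c n 4 r = inKAfter c n 2 r
inClassAfter c n 5 r = inKAfter c n 3 r
inClassAfter c n 6 r = inKAfter c n 4 r
inClassAfter c n 7 r = in7After c n r
inClassAfter c n _ r = false

cardAfter : Context → ℕ → ℕ → ℕ
cardAfter c n i = length (filterᵇ (inClassAfter c n i) (words n))

inL-++ : ∀ v r n → inL (length v + n) (v ++ r) ≡ inLAfter (context v) n r
inL-++ v r n = cong₂ _∧_ (length-++-≡ᵇ v r n) (validFrom-++ 1 v r)

in1-++ : ∀ v r i → in1 (length v + suc i) (v ++ r) ≡ in1After (context v) (suc i) r
in1-++ v r i = cong₂ _∧_ (inL-++ v r (suc i)) (cong (_≡ᵇ 1) (letter-++ v r i))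

maxPrefix-++ : ∀ v r i → maxPrefix (length v + suc i ∸ 1) (v ++ r) ≡ foldl _⊔_ (top (context v)) (take i r)
maxPrefix-++ v r i = begin
  foldl _⊔_ 1 (take (length v + suc i ∸ 1) (v ++ r))
    ≡⟨ cong (λ p → foldl _⊔_ 1 (take p (v ++ r))) (+-suc-∸-1 (length v) i) ⟩
  foldl _⊔_ 1 (take (length v + i) (v ++ r))  ≡⟨ cong (foldl _⊔_ 1) (take-++ v r i) ⟩
  foldl _⊔_ 1 (v ++ take i r)                 ≡⟨ foldl-++ _⊔_ 1 v (take i r) ⟩
  foldl _⊔_ (foldl _⊔_ 1 v) (take i r)        ∎

in2-++ : ∀ v r i → in2 (length v + suc i) (v ++ r) ≡ in2After (context v) (suc i) r
in2-++ v r i = cong₂ _∧_ (inL-++ v r (suc i))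
  (cong₂ _∨_ (cong₂ _≡ᵇ_ (letter-++ v r i) (cong suc (maxPrefix-++ v r i)))
             (cong (_≡ᵇ 4) (letter-++ v r i)))

inK-++ : ∀ v r j k → inK (length v + suc (suc j)) k (v ++ r) ≡ inKAfter (context v) (suc (suc j)) k r
inK-++ v r j k = cong₂ _∧_ (inL-++ v r _) (cong₂ _∧_
  (cong not (cong₂ _∨_ (in1-++ v r (suc j)) (in2-++ v r (suc j))))
  (cong₂ _∧_ (cong (_≡ᵇ k) (trans (cong (λ p → letter p (v ++ r)) n∸1) (letter-++ v r j)))
             (cong not (cong₂ _∨_ (erased in1 in1After in1-++) (erased in2 in2After in2-++)))))
  where
  n∸1 : length v + suc (suc j) ∸ 1 ≡ length v + suc j
  n∸1 = +-suc-∸-1 (length v) (suc j)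
  erased : (cls : ℕ → List ℕ → Bool) → (clsAfter : Context → ℕ → List ℕ → Bool) →
           (∀ u s i → cls (length u + suc i) (u ++ s) ≡ clsAfter (context u) (suc i) s) →
           cls (length v + suc (suc j) ∸ 1) (erase (length v + suc (suc j) ∸ 1) (v ++ r))
             ≡ clsAfter (context v) (suc j) (erase (suc j) r)
  erased cls clsAfter cls-++ = begin
    cls (length v + suc (suc j) ∸ 1) (erase (length v + suc (suc j) ∸ 1) (v ++ r))
      ≡⟨ cong (λ p → cls p (erase p (v ++ r))) n∸1 ⟩
    cls (length v + suc j) (erase (length v + suc j) (v ++ r))
      ≡⟨ cong (cls (length v + suc j)) (erase-++ v r j) ⟩
    cls (length v + suc j) (v ++ erase (suc j) r)
      ≡⟨ cls-++ v (erase (suc j) r) j ⟩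
    clsAfter (context v) (suc j) (erase (suc j) r) ∎

in7-++ : ∀ v r j → in7 (length v + suc (suc j)) (v ++ r) ≡ in7After (context v) (suc (suc j)) r
in7-++ v r j = cong₂ _∧_ (inL-++ v r _) (cong not
  (cong₂ _∨_ (in1-++ v r (suc j)) (cong₂ _∨_ (in2-++ v r (suc j))
  (cong₂ _∨_ (inK-++ v r j 1) (cong₂ _∨_ (inK-++ v r j 2)
  (cong₂ _∨_ (inK-++ v r j 3) (inK-++ v r j 4)))))))

inClass-++ : ∀ v r j i →
  inClass (length v + suc (suc j)) i (v ++ r) ≡ inClassAfter (context v) (suc (suc j)) i r
inClass-++ v r j 1 = in1-++ v r (suc j)
inClass-++ v r j 2 = in2-++ v r (suc j)
inClass-++ v r j 3 = inK-++ v r j 1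
inClass-++ v r j 4 = inK-++ v r j 2
inClass-++ v r j 5 = inK-++ v r j 3
inClass-++ v r j 6 = inK-++ v r j 4
inClass-++ v r j 7 = in7-++ v r j
inClass-++ v r j 0 = refl
inClass-++ v r j (suc (suc (suc (suc (suc (suc (suc (suc _)))))))) = refl

card-split : ∀ k j i → card (suc (suc j) + k) i ≡ ∑[ v ∈ words k ] cardAfter (context v) (suc (suc j)) i
card-split k j i = begin
  card (m + k) i                                                      ≡⟨ cong (λ n → card n i) (+-comm m k) ⟩
  card (k + m) i                                                      ≡⟨ length-filterᵇ _ (words (k + m)) ⟩
  ∑[ a ∈ words (k + m) ] 𝟙 (inClass (k + m) i a)                      ≡⟨ ∑-words-+ k m _ ⟩
  ∑[ v ∈ words k ] ∑[ r ∈ words m ] 𝟙 (inClass (k + m) i (v ++ r))   ≡⟨ ∑-words-cong k local ⟩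
  ∑[ v ∈ words k ] ∑[ r ∈ words m ] 𝟙 (inClassAfter (context v) m i r)
    ≡⟨ ∑-cong (words k) (λ v → sym (length-filterᵇ _ (words m))) ⟩
  ∑[ v ∈ words k ] cardAfter (context v) m i                          ∎
  where
  m = suc (suc j)
  local : ∀ v → length v ≡ k →
    ∑[ r ∈ words m ] 𝟙 (inClass (k + m) i (v ++ r)) ≡ ∑[ r ∈ words m ] 𝟙 (inClassAfter (context v) m i r)
  local v refl = ∑-cong (words m) (λ r → cong 𝟙 (inClass-++ v r j i))

cards-split : ∀ k j (is : List ℕ) →
  ∑[ i ∈ is ] card (suc (suc j) + k) i ≡ ∑[ v ∈ words k ] ∑[ i ∈ is ] cardAfter (context v) (suc (suc j)) i
cards-split k j is =
  trans (∑-cong is (card-split k j)) (∑-swap is (words k) (λ i v → cardAfter (context v) (suc (suc j)) i))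

context-top-bounds : ∀ v → T (valid (context v)) → 1 ≤ top (context v) × top (context v) ≤ 4
context-top-bounds v valid = m≤foldl-⊔ 1 v , foldl-⊔-≤4 v (s≤s z≤n) valid

initial : Context → Bool
initial c = valid c ∧ (top c ≡ᵇ 1)

cardAfter-balance : ∀ c → (T (valid c) → 1 ≤ top c × top c ≤ 4) →
  ∑[ i ∈ 6 ∷ 7 ∷ [] ] cardAfter c 3 i ≡ ∑[ i ∈ 3 ∷ 4 ∷ 5 ∷ 6 ∷ 7 ∷ [] ] cardAfter c 2 i + 𝟙 (initial c)
cardAfter-balance ⟨ false , _ ⟩ _ = refl
cardAfter-balance ⟨ true  , 1 ⟩ _ = refl
cardAfter-balance ⟨ true  , 2 ⟩ _ = refl
cardAfter-balance ⟨ true  , 3 ⟩ _ = refl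
cardAfter-balance ⟨ true  , 4 ⟩ _ = refl
cardAfter-balance ⟨ true  , 0 ⟩ bounds = contradiction (proj₁ (bounds _)) λ ()
cardAfter-balance ⟨ true  , suc (suc (suc (suc (suc _)))) ⟩ bounds =
  contradiction (proj₂ (bounds _)) λ { (s≤s (s≤s (s≤s (s≤s ())))) }

2≤m⇒m≡ᵇ1≡false : ∀ {m} → 2 ≤ m → (m ≡ᵇ 1) ≡ false
2≤m⇒m≡ᵇ1≡false (s≤s (s≤s _)) = refl

-- Only 1⋯1 is initial: a first letter 2 raises the maximum, 3 and 4 are invalid.
∑-initial : ∀ k → ∑[ v ∈ words k ] 𝟙 (initial (context v)) ≡ 1
∑-initial zero    = refl
∑-initial (suc k) = begin
  ∑[ v ∈ words (suc k) ] 𝟙 (initial (context v))                       ≡⟨ ∑-words-suc k _ ⟩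
  ∑[ w ∈ words k ] ∑[ x ∈ alphabet ] 𝟙 (initial (context (x ∷ w)))    ≡⟨ ∑-cong (words k) ∑-initial-∷ ⟩
  ∑[ w ∈ words k ] 𝟙 (initial (context w))                             ≡⟨ ∑-initial k ⟩
  1                                                                    ∎
  where
  ∑-initial-∷ : ∀ w → ∑[ x ∈ alphabet ] 𝟙 (initial (context (x ∷ w))) ≡ 𝟙 (initial (context w))
  ∑-initial-∷ w = begin
    𝟙 (initial (context w)) + (𝟙 (validFrom 2 w ∧ (foldl _⊔_ 2 w ≡ᵇ 1)) + 0)
      ≡⟨ cong (λ b → 𝟙 (initial (context w)) + (𝟙 (validFrom 2 w ∧ b) + 0)) (2≤m⇒m≡ᵇ1≡false (m≤foldl-⊔ 2 w)) ⟩
    𝟙 (initial (context w)) + (𝟙 (validFrom 2 w ∧ false) + 0)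
      ≡⟨ cong (λ b → 𝟙 (initial (context w)) + (𝟙 b + 0)) (∧-zeroʳ (validFrom 2 w)) ⟩
    𝟙 (initial (context w)) + 0
      ≡⟨ +-identityʳ _ ⟩
    𝟙 (initial (context w)) ∎

mainTheorem3 : (n : ℕ) → 3 ≤ n →
    card n 6 + card n 7
      ≡ card (n ∸ 1) 3 + card (n ∸ 1) 4 + card (n ∸ 1) 5 + card (n ∸ 1) 6 + card (n ∸ 1) 7 + 1
mainTheorem3 .(3 + N) (s≤s (s≤s (s≤s {n = N} z≤n))) = begin
  card (3 + N) 6 + card (3 + N) 7
    ≡⟨ cong (card (3 + N) 6 +_) (sym (+-identityʳ _)) ⟩
  ∑[ i ∈ 6 ∷ 7 ∷ [] ] card (3 + N) i
    ≡⟨ cards-split N 1 (6 ∷ 7 ∷ []) ⟩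
  ∑[ v ∈ words N ] ∑[ i ∈ 6 ∷ 7 ∷ [] ] cardAfter (context v) 3 i
    ≡⟨ ∑-cong (words N) (λ v → cardAfter-balance (context v) (context-top-bounds v)) ⟩
  ∑[ v ∈ words N ] (∑[ i ∈ 3 ∷ 4 ∷ 5 ∷ 6 ∷ 7 ∷ [] ] cardAfter (context v) 2 i + 𝟙 (initial (context v)))
    ≡⟨ ∑-+ (words N) _ (𝟙 ∘ initial ∘ context) ⟩
  ∑[ v ∈ words N ] ∑[ i ∈ 3 ∷ 4 ∷ 5 ∷ 6 ∷ 7 ∷ [] ] cardAfter (context v) 2 i
    + ∑[ v ∈ words N ] 𝟙 (initial (context v))
    ≡⟨ cong₂ _+_ (sym (cards-split N 0 (3 ∷ 4 ∷ 5 ∷ 6 ∷ 7 ∷ []))) (∑-initial N) ⟩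
  ∑[ i ∈ 3 ∷ 4 ∷ 5 ∷ 6 ∷ 7 ∷ [] ] card (2 + N) i + 1
    ≡⟨ cong (_+ 1) (reassociate (card (2 + N) 3) _ _ _ _) ⟩
  card (2 + N) 3 + card (2 + N) 4 + card (2 + N) 5 + card (2 + N) 6 + card (2 + N) 7 + 1 ∎
  where
  reassociate : ∀ a b c d e → a + (b + (c + (d + (e + 0)))) ≡ a + b + c + d + e
  reassociate = solve-∀
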